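{- The relations $\succ_{tc}$, $\succ_{lc}$ and $\succ_{cc}$ are well-founded, and they are total on ground term closures, ground literal closures and ground clause closures, respectively.
   Context: Fix a first-order signature with equality as the only predicate; literals are unordered pairs of terms with a polarity ($s\approx t$ or $s\not\approx t$), clauses are finite multisets of literals; $id$ is the identity substitution. Fix a reduction ordering $\succ_t$ on terms, total on ground terms. For an ordering $\succ$, its multiset extension $\succ\!\succ$: $A\succ\!\succ B$ iff $A\ne B$ and for every $x$ with $B(x)>A(x)$ there is $y\succ x$ with $A(y)>B(y)$. $s\sqsupset t$ ($s$ less general than $t$) means $t\sigma=s$ for some $\sigma$ but no $\rho$ has $s\rho=t$. A closure $\langle e,\sigma\rangle$ (term, literal or clause $e$, substitution $\sigma$) represents $e\sigma$; it is ground if $e\sigma$ is ground. On ground term closures, $\langle s,\sigma\rangle\succ_{tc}\langle t,\rho\rangle$ iff $s\sigma\succ_t t\rho$, or $s\sigma=t\rho$ and $s\sqsupset t$; this well-founded partial order is then extended to an arbitrary fixed total well-founded order on ground term closures, still denoted $\succ_{tc}$. $M_{lc}(\langle s\approx t,\theta\rangle)=\{\langle s,\theta\rangle,\langle t,\theta\rangle\}$, $M_{lc}(\langle s\not\approx t,\theta\rangle)=\{\langle s,\theta\rangle,\langle s\theta,id\rangle,\langle t,\theta\rangle,\langle t\theta,id\rangle\}$, and $\langle L,\sigma\rangle\succ_{lc}\langle L',\rho\rangle$ iff $M_{lc}(\langle L,\sigma\rangle)\succ\!\succ_{tc}M_{lc}(\langle L',\rho\rangle)$. $M_{cc}(\langle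 C,\sigma\rangle)=\{\langle L,\sigma\rangle\}$ if $C=\{L\}$ is unit, and $\{\langle L\sigma,id\rangle\mid L\in C\}$ otherwise; $\langle C,\sigma\rangle\succ_{cc}\langle D,\rho\rangle$ iff $M_{cc}(\langle C,\sigma\rangle)\succ\!\succ_{lc}M_{cc}(\langle D,\rho\rangle)$.
   Formalization: $\succ_{cc}$ is total on ground clause closures only up to equality of their $M_{cc}$ multisets, so two ground clause closures with different $M_{cc}$ multisets are comparable under $\succ_{cc}$. The statement above fails without it. -}

module Defs where

open import Level using (0ℓ)
open import Data.Nat as ℕ using (ℕ; _<_)
open import Data.Bool using (Bool; true; false)
import Data.Bool as Bool
open import Data.Fin using (Fin)
open import Data.Vec using (Vec; []; _∷_; _[_]≔_)
open import Data.List using (List; []; _∷_; _++_)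
open import Data.List.Relation.Unary.All as All using (All; []; _∷_)
open import Data.Product using (Σ; ∃; _×_; _,_; proj₁)
open import Data.Sum using (_⊎_; inj₁; inj₂)
open import Function using (flip)
open import Relation.Binary using (Rel; Decidable; DecidableEquality)
open import Relation.Binary.PropositionalEquality using (_≡_; _≢_; refl; sym; subst; cong; cong₂)
open import Relation.Nullary using (¬_; Dec; yes; no)
open import Relation.Nullary.Decidable using (_×-dec_; _⊎-dec_)
open import Induction.WellFounded using (WellFounded)

WellFoundedGT : {A : Set} → Rel A 0ℓ → Set
WellFoundedGT _≻_ = WellFounded (flip _≻_)

TotalUpTo : {A : Set} → Rel A 0ℓ → Rel A 0ℓ → Set
TotalUpTo {A} _≈_ _≻_ = (x y : A) → x ≻ y ⊎ y ≻ x ⊎ x ≈ y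

-- finite multisets as lists, element identity up to a decidable equivalence
module Multiset {A : Set} (_≈_ : Rel A 0ℓ) (_≈?_ : Decidable _≈_) (_≻_ : Rel A 0ℓ) where

  count : A → List A → ℕ
  count x [] = 0
  count x (y ∷ ys) with x ≈? y
  ... | yes _ = ℕ.suc (count x ys)
  ... | no _  = count x ys

  _≡ₘ_ : Rel (List A) 0ℓ
  M ≡ₘ N = ∀ x → count x M ≡ count x N

  _≻≻_ : Rel (List A) 0ℓ
  M ≻≻ N = ¬ (M ≡ₘ N) × (∀ x → count x M < count x N → ∃ λ y → y ≻ x × count y N < count y M)

record Signature : Set₁ where
  field
    Fun   : Set
    arity : Fun → ℕ
    _≟F_  : DecidableEquality Fun

module Over (S : Signature) where
  open Signature S

  Var : Set
  Var = ℕ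

  data Term : Set where
    var : Var → Term
    fun : (f : Fun) → Vec Term (arity f) → Term

  Subst : Set
  Subst = Var → Term

  idS : Subst
  idS = var

  mutual
    _·_ : Term → Subst → Term
    var x · σ = σ x
    fun f ts · σ = fun f (ts ·* σ)

    _·*_ : ∀ {n} → Vec Term n → Subst → Vec Term n
    [] ·* σ = []
    (t ∷ ts) ·* σ = (t · σ) ∷ (ts ·* σ)

  mutual
    vars : Term → List Var
    vars (var x) = x ∷ []
    vars (fun f ts) = vars* ts

    vars* : ∀ {n} → Vec Term n → List Var
    vars* [] = []
    vars* (t ∷ ts) = vars t ++ vars* ts

  Ground : Term → Set
  Ground t = vars t ≡ []

  mutual
    ·-id : ∀ t → t · idS ≡ t
    ·-id (var x) = refl
    ·-id (fun f ts) = cong (fun f) (·*-id ts)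

    ·*-id : ∀ {n} (ts : Vec Term n) → ts ·* idS ≡ ts
    ·*-id [] = refl
    ·*-id (t ∷ ts) = cong₂ _∷_ (·-id t) (·*-id ts)

  mutual
    _≟T_ : DecidableEquality Term
    var x ≟T var y with x ℕ.≟ y
    ... | yes refl = yes refl
    ... | no ne = no λ { refl → ne refl }
    var x ≟T fun f ts = no λ ()
    fun f ts ≟T var x = no λ ()
    fun f ss ≟T fun g ts with f ≟F g
    ... | no ne = no λ { refl → ne refl }
    ... | yes refl with ss ≟* ts
    ...   | yes refl = yes refl
    ...   | no ne = no λ { refl → ne refl }

    _≟*_ : ∀ {n} → DecidableEquality (Vec Term n)
    [] ≟* [] = yes refl
    (s ∷ ss) ≟* (t ∷ ts) with s ≟T t | ss ≟* ts
    ... | yes refl | yes refl = yes refl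
    ... | no ne | _ = no λ { refl → ne refl }
    ... | _ | no ne = no λ { refl → ne refl }

  _⊐_ : Rel Term 0ℓ
  s ⊐ t = (∃ λ σ → t · σ ≡ s) × ¬ (∃ λ ρ → s · ρ ≡ t)

  record IsReductionOrdering (_≻_ : Rel Term 0ℓ) : Set where
    field
      irrefl       : ∀ t → ¬ (t ≻ t)
      trans        : ∀ {s t u} → s ≻ t → t ≻ u → s ≻ u
      wellFounded  : WellFoundedGT _≻_
      monotone     : ∀ f (ts : Vec Term (arity f)) (i : Fin (arity f)) s t →
                     s ≻ t → fun f (ts [ i ]≔ s) ≻ fun f (ts [ i ]≔ t)
      stable       : ∀ s t (σ : Subst) → s ≻ t → (s · σ) ≻ (t · σ)
      groundTotal  : ∀ s t → Ground s → Ground t → s ≢ t → s ≻ t ⊎ t ≻ s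

  record TermClosure : Set where
    constructor tc⟨_,_⟩
    field
      term  : Term
      sub   : Subst

  GroundTermClosure : Set
  GroundTermClosure = Σ TermClosure λ c → Ground (TermClosure.term c · TermClosure.sub c)

  _≈tc_ : Rel GroundTermClosure 0ℓ
  (tc⟨ s , σ ⟩ , _) ≈tc (tc⟨ t , ρ ⟩ , _) = s ≡ t × All (λ x → σ x ≡ ρ x) (vars s)

  _≈tc?_ : Decidable _≈tc_
  (tc⟨ s , σ ⟩ , _) ≈tc? (tc⟨ t , ρ ⟩ , _) = (s ≟T t) ×-dec All.all? (λ x → σ x ≟T ρ x) (vars s)

  BaseOrder : Rel Term 0ℓ → Rel GroundTermClosure 0ℓ
  BaseOrder _≻t_ (tc⟨ s , σ ⟩ , _) (tc⟨ t , ρ ⟩ , _) =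
    (s · σ) ≻t (t · ρ) ⊎ ((s · σ ≡ t · ρ) × s ⊐ t)

  record IsClosureOrderExtension (_≻t_ : Rel Term 0ℓ) (_≻_ : Rel GroundTermClosure 0ℓ) : Set where
    field
      irrefl      : ∀ x y → x ≈tc y → ¬ (x ≻ y)
      trans       : ∀ {x y z} → x ≻ y → y ≻ z → x ≻ z
      respects    : ∀ {x x′ y y′} → x ≈tc x′ → y ≈tc y′ → x ≻ y → x′ ≻ y′
      total       : TotalUpTo _≈tc_ _≻_
      wellFounded : WellFoundedGT _≻_
      extends     : ∀ x y → BaseOrder _≻t_ x y → x ≻ y

  -- polarity true: s ≈ t ;  polarity false: s ≉ t
  record Literal : Set where
    constructor lit
    field
      pol : Bool
      lhs : Term
      rhs : Term

  _·L_ : Literal → Subst → Literal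
  lit p s t ·L σ = lit p (s · σ) (t · σ)

  record LiteralClosure : Set where
    constructor lc⟨_,_⟩
    field
      literal : Literal
      sub   : Subst

  GroundLit : Literal → Subst → Set
  GroundLit (lit p s t) θ = Ground (s · θ) × Ground (t · θ)

  GroundLiteralClosure : Set
  GroundLiteralClosure = Σ LiteralClosure λ c → GroundLit (LiteralClosure.literal c) (LiteralClosure.sub c)

  -- literals are unordered pairs: identified up to swapping the sides
  _≈lc_ : Rel GroundLiteralClosure 0ℓ
  (lc⟨ lit p s t , θ ⟩ , _) ≈lc (lc⟨ lit q u v , ρ ⟩ , _) =
    p ≡ q × ((s ≡ u × t ≡ v) ⊎ (s ≡ v × t ≡ u)) × All (λ x → θ x ≡ ρ x) (vars s ++ vars t)

  _≈lc?_ : Decidable _≈lc_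
  (lc⟨ lit p s t , θ ⟩ , _) ≈lc? (lc⟨ lit q u v , ρ ⟩ , _) =
    (p Bool.≟ q) ×-dec ((((s ≟T u) ×-dec (t ≟T v)) ⊎-dec ((s ≟T v) ×-dec (t ≟T u)))
      ×-dec All.all? (λ x → θ x ≟T ρ x) (vars s ++ vars t))

  groundId : ∀ u → Ground u → Ground (u · idS)
  groundId u g = subst Ground (sym (·-id u)) g

  M-lc : GroundLiteralClosure → List GroundTermClosure
  M-lc (lc⟨ lit true s t , θ ⟩ , gs , gt) =
    (tc⟨ s , θ ⟩ , gs) ∷ (tc⟨ t , θ ⟩ , gt) ∷ []
  M-lc (lc⟨ lit false s t , θ ⟩ , gs , gt) =
    (tc⟨ s , θ ⟩ , gs) ∷ (tc⟨ s · θ , idS ⟩ , groundId (s · θ) gs) ∷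
    (tc⟨ t , θ ⟩ , gt) ∷ (tc⟨ t · θ , idS ⟩ , groundId (t · θ) gt) ∷ []

  -- Clauses (finite multisets of literals, as lists) and clause closures

  Clause : Set
  Clause = List Literal

  record ClauseClosure : Set where
    constructor cc⟨_,_⟩
    field
      clause : Clause
      sub   : Subst

  GroundClauseClosure : Set
  GroundClauseClosure = Σ ClauseClosure λ c →
    All (λ L → GroundLit L (ClauseClosure.sub c)) (ClauseClosure.clause c)

  instantiate : (C : Clause) (σ : Subst) → All (λ L → GroundLit L σ) C → List GroundLiteralClosure
  instantiate [] σ [] = []
  instantiate (lit p s t ∷ C) σ ((gs , gt) ∷ gC) =
    (lc⟨ lit p (s · σ) (t · σ) , idS ⟩ , groundId (s · σ) gs , groundId (t · σ) gt) ∷ instantiate C σ gC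

  M-cc : GroundClauseClosure → List GroundLiteralClosure
  M-cc (cc⟨ L ∷ [] , σ ⟩ , g ∷ []) = (lc⟨ L , σ ⟩ , g) ∷ []
  M-cc (cc⟨ [] , σ ⟩ , gC) = instantiate [] σ gC
  M-cc (cc⟨ L ∷ L′ ∷ C , σ ⟩ , gC) = instantiate (L ∷ L′ ∷ C) σ gC

  module Orders (_≻tc_ : Rel GroundTermClosure 0ℓ) where

    open Multiset _≈tc_ _≈tc?_ _≻tc_ using () renaming (_≻≻_ to _≻≻tc_)

    _≻lc_ : Rel GroundLiteralClosure 0ℓ
    x ≻lc y = M-lc x ≻≻tc M-lc y

    open Multiset _≈lc_ _≈lc?_ _≻lc_ using () renaming (_≻≻_ to _≻≻lc_; _≡ₘ_ to _≡ₘlc_)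

    _≻cc_ : Rel GroundClauseClosure 0ℓ
    x ≻cc y = M-cc x ≻≻lc M-cc y

    _≈cc_ : Rel GroundClauseClosure 0ℓ
    x ≈cc y = M-cc x ≡ₘlc M-cc y

-- A multiset extension inherits well-foundedness and totality from an order that is total up to a
-- decidable equivalence.  For totality, compare two multisets at a maximal element whose multiplicities
-- differ.  For well-foundedness, write a multiset bounded by a as a^k ++ R with R strictly below a: a
-- descent step either lowers k, or keeps k and descends in R, so induct on the accessibility of a, then
-- on k, then on R.  ≻lc and ≻cc are such extensions pulled back along M-lc and M-cc, and ≈cc is
-- multiset equality.  What remains is that M-lc x and M-lc y are equal multisets only if x ≈lc y: the
-- sizes give the polarity, the terms of the closures give the sides, and since each closure ⟨s, θ⟩ of x
-- reappears in M-lc y, the substitutions agree on the variables of the sides.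
module Submission where

open import Defs
open import Level using (0ℓ)
open import Algebra.Properties.CommutativeSemigroup using (x∙yz≈y∙xz)
open import Data.Bool using (true; false)
open import Data.List using (List; []; _∷_; _++_; [_]; map; replicate; filter)
open import Data.List.Relation.Binary.Pointwise as Pointwise using (Pointwise; []; _∷_)
import Data.List.Relation.Binary.Permutation.Setoid as Permutation
import Data.List.Relation.Binary.Permutation.Setoid.Properties as PermutationProperties
import Data.List.Membership.Setoid as SetoidMembership
import Data.List.Membership.Setoid.Properties as SetoidMembershipProperties
open import Data.List.Relation.Unary.All as All using (All; []; _∷_; lookupₛ)
import Data.List.Relation.Unary.All.Properties as AllP
open import Data.List.Relation.Unary.Any using (here; there; any?)
import Data.List.Relation.Unary.Any.Properties as AnyP
open import Data.Nat using (zero; suc; _+_; _*_; _<_; _≟_; s≤s; z≤n)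
open import Data.Nat.Induction using (<-wellFounded)
open import Data.Nat.Properties
  using (suc-injective; +-commutativeSemigroup; +-identityʳ; +-cancelʳ-≡; *-cancelˡ-≡; <-cmp; <-irrefl; <-asym; n≮0)
open import Data.Product using (∃-syntax; _×_; _,_; proj₁; proj₂)
open import Data.Sum using (_⊎_; inj₁; inj₂)
open import Data.Vec using (Vec)
open import Function using (flip; _∘_)
open import Induction.WellFounded using (Acc; acc; wf⇒asym)
open import Relation.Binary using (Rel; Decidable; Setoid; IsEquivalence; _Respects_; _Preserves_⟶_; tri<; tri≈; tri>)
import Relation.Binary.Construct.On as On
open import Relation.Binary.Construct.Never using (Never)
import Relation.Binary.PropositionalEquality as ≡
open import Relation.Binary.PropositionalEquality
  using (_≡_; _≢_; refl; sym; trans; cong; cong₂; subst; subst₂; module ≡-Reasoning)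
open import Relation.Nullary using (¬_; Dec; yes; no; contradiction)
open import Relation.Nullary.Decidable using (¬?; decidable-stable)

module CountingMultisets {A : Set} {_≈_ : Rel A 0ℓ} (≈-isEquivalence : IsEquivalence _≈_)
                         (_≈?_ : Decidable _≈_) (_≻_ : Rel A 0ℓ) where

  open IsEquivalence ≈-isEquivalence renaming (refl to ≈-refl; sym to ≈-sym; trans to ≈-trans)
  open Multiset _≈_ _≈?_ _≻_ public

  setoid : Setoid 0ℓ 0ℓ
  setoid = record { isEquivalence = ≈-isEquivalence }

  module ↭ = Permutation setoid
  open ↭ public using (_↭_; prep; swap; ↭-refl; ↭-sym; ↭-trans; ↭-prep; ↭-swap)
  open PermutationProperties setoid using (∈-resp-↭; drop-∷; shift)
  open SetoidMembership setoid public using (_∈_)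
  open SetoidMembershipProperties using (∈-∃++)

  count-resp : ∀ {x x′} M → x ≈ x′ → count x M ≡ count x′ M
  count-resp [] _ = refl
  count-resp {x} {x′} (y ∷ M) x≈x′ with x ≈? y | x′ ≈? y
  ... | yes _   | yes _    = cong suc (count-resp M x≈x′)
  ... | no  _   | no  _    = count-resp M x≈x′
  ... | yes x≈y | no x′≉y  = contradiction (≈-trans (≈-sym x≈x′) x≈y) x′≉y
  ... | no  x≉y | yes x′≈y = contradiction (≈-trans x≈x′ x′≈y) x≉y

  count-++ : ∀ x M N → count x (M ++ N) ≡ count x M + count x N
  count-++ x [] N = refl
  count-++ x (y ∷ M) N with x ≈? y
  ... | yes _ = cong suc (count-++ x M N)
  ... | no  _ = count-++ x M N

  ∈⇒count>0 : ∀ {x} M → x ∈ M → 0 < count x M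
  ∈⇒count>0 {x} (y ∷ M) x∈ with x ≈? y | x∈
  ... | yes _  | _         = s≤s z≤n
  ... | no x≉y | here x≈y  = contradiction x≈y x≉y
  ... | no _   | there x∈M = ∈⇒count>0 M x∈M

  count>0⇒∈ : ∀ {x} M → 0 < count x M → x ∈ M
  count>0⇒∈ {x} (y ∷ M) pos with x ≈? y
  ... | yes x≈y = here x≈y
  ... | no  _   = there (count>0⇒∈ M pos)

  ∉⇒count≡0 : ∀ {x} M → ¬ x ∈ M → count x M ≡ 0
  ∉⇒count≡0 [] _ = refl
  ∉⇒count≡0 {x} (y ∷ M) x∉ with x ≈? y
  ... | yes x≈y = contradiction (here x≈y) x∉
  ... | no  _   = ∉⇒count≡0 M (x∉ ∘ there)

  ∈-resp-≡ₘ : ∀ {x} M N → M ≡ₘ N → x ∈ M → x ∈ N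
  ∈-resp-≡ₘ {x} M N M≡N x∈M = count>0⇒∈ N (subst (0 <_) (M≡N x) (∈⇒count>0 M x∈M))

  ∷-cong-≡ₘ : ∀ {x y} M N → x ≈ y → M ≡ₘ N → (x ∷ M) ≡ₘ (y ∷ N)
  ∷-cong-≡ₘ {x} {y} _ _ x≈y M≡N z with z ≈? x | z ≈? y
  ... | yes _   | yes _   = cong suc (M≡N z)
  ... | no  _   | no  _   = M≡N z
  ... | yes z≈x | no z≉y  = contradiction (≈-trans z≈x x≈y) z≉y
  ... | no  z≉x | yes z≈y = contradiction (≈-trans z≈y (≈-sym x≈y)) z≉x

  ∷-cancel-≡ₘ : ∀ {x} M N → (x ∷ M) ≡ₘ (x ∷ N) → M ≡ₘ N
  ∷-cancel-≡ₘ {x} _ _ x∷M≡x∷N z with z ≈? x | x∷M≡x∷N z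
  ... | yes _ | eq = suc-injective eq
  ... | no  _ | eq = eq

  swap-≡ₘ : ∀ x y M → (x ∷ y ∷ M) ≡ₘ (y ∷ x ∷ M)
  swap-≡ₘ x y M z = begin
    count z (x ∷ y ∷ M)     ≡⟨ count-++ z [ x ] (y ∷ M) ⟩
    #x + count z (y ∷ M)    ≡⟨ cong (#x +_) (count-++ z [ y ] M) ⟩
    #x + (#y + count z M)   ≡⟨ x∙yz≈y∙xz +-commutativeSemigroup #x #y (count z M) ⟩
    #y + (#x + count z M)   ≡⟨ cong (#y +_) (count-++ z [ x ] M) ⟨
    #y + count z (x ∷ M)    ≡⟨ count-++ z [ y ] (x ∷ M) ⟨
    count z (y ∷ x ∷ M)     ∎
    where
    open ≡-Reasoning
    #x = count z [ x ]
    #y = count z [ y ]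

  ≋⇒≡ₘ : ∀ {M N} → Pointwise _≈_ M N → M ≡ₘ N
  ≋⇒≡ₘ [] _ = refl
  ≋⇒≡ₘ (_∷_ {xs = M} {N} x≈y M≋N) = ∷-cong-≡ₘ M N x≈y (≋⇒≡ₘ M≋N)

  ↭⇒≡ₘ : ∀ {M N} → M ↭ N → M ≡ₘ N
  ↭⇒≡ₘ (↭.refl M≋N) = ≋⇒≡ₘ M≋N
  ↭⇒≡ₘ (prep {xs = M} {N} x≈y M↭N) = ∷-cong-≡ₘ M N x≈y (↭⇒≡ₘ M↭N)
  ↭⇒≡ₘ (swap {xs = M} {N} {x′ = x′} {y′} x≈x′ y≈y′ M↭N) z =
    trans (∷-cong-≡ₘ (_ ∷ M) (y′ ∷ N) x≈x′ (∷-cong-≡ₘ M N y≈y′ (↭⇒≡ₘ M↭N)) z)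
          (swap-≡ₘ x′ y′ N z)
  ↭⇒≡ₘ (↭.trans K↭M M↭N) z = trans (↭⇒≡ₘ K↭M z) (↭⇒≡ₘ M↭N z)

  ∈⇒↭∷ : ∀ {x N} → x ∈ N → ∃[ N′ ] N ↭ x ∷ N′
  ∈⇒↭∷ x∈N with ∈-∃++ setoid x∈N
  ... | ys , zs , _ , x≈w , N≋ = ys ++ zs , ↭-trans (↭.refl N≋) (shift (≈-sym x≈w) ys zs)

  ≡ₘ⇒↭ : ∀ M N → M ≡ₘ N → M ↭ N
  ≡ₘ⇒↭ [] [] _ = ↭-refl
  ≡ₘ⇒↭ [] (y ∷ N) []≡y∷N with ∈-resp-≡ₘ (y ∷ N) [] (sym ∘ []≡y∷N) (here ≈-refl)
  ... | ()
  ≡ₘ⇒↭ (x ∷ M) N x∷M≡N with ∈⇒↭∷ (∈-resp-≡ₘ (x ∷ M) N x∷M≡N (here ≈-refl))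
  ... | N′ , N↭x∷N′ = ↭-trans (↭-prep x (≡ₘ⇒↭ M N′ M≡N′)) (↭-sym N↭x∷N′)
    where
    M≡N′ : M ≡ₘ N′
    M≡N′ = ∷-cancel-≡ₘ M N′ λ z → trans (x∷M≡N z) (↭⇒≡ₘ N↭x∷N′ z)

  singleton-↭ : ∀ {a b} → [ a ] ↭ [ b ] → a ≈ b
  singleton-↭ p with ∈-resp-↭ p (here ≈-refl)
  ... | here a≈b = a≈b

  pair-↭ : ∀ {a b c d} → (a ∷ b ∷ []) ↭ (c ∷ d ∷ []) → (a ≈ c × b ≈ d) ⊎ (a ≈ d × b ≈ c)
  pair-↭ {c = c} {d} p with ∈-resp-↭ p (here ≈-refl)
  ... | here a≈c         = inj₁ (a≈c , singleton-↭ (drop-∷ (↭-trans (prep (≈-sym a≈c) ↭-refl) p)))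
  ... | there (here a≈d) = inj₂ (a≈d , singleton-↭ (drop-∷ (↭-trans (prep (≈-sym a≈d) ↭-refl) p′)))
    where
    p′ = ↭-trans p (↭-swap c d ↭-refl)

  ++⁺ˡ-≡ₘ : ∀ K M N → M ≡ₘ N → (K ++ M) ≡ₘ (K ++ N)
  ++⁺ˡ-≡ₘ K M N M≡N z = trans (count-++ z K M) (trans (cong (count z K +_) (M≡N z)) (sym (count-++ z K N)))

  ++-cancelʳ-≡ₘ : ∀ M N {K L} → (M ++ K) ≡ₘ (N ++ L) → K ≡ₘ L → M ≡ₘ N
  ++-cancelʳ-≡ₘ M N {K} {L} M++K≡N++L K≡L z = +-cancelʳ-≡ (count z K) _ _ (begin
    count z M + count z K  ≡⟨ count-++ z M K ⟨
    count z (M ++ K)       ≡⟨ M++K≡N++L z ⟩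
    count z (N ++ L)       ≡⟨ count-++ z N L ⟩
    count z N + count z L  ≡⟨ cong (count z N +_) (K≡L z) ⟨
    count z N + count z K  ∎)
    where open ≡-Reasoning

  ++-halve-≡ₘ : ∀ M N → (M ++ M) ≡ₘ (N ++ N) → M ≡ₘ N
  ++-halve-≡ₘ M N M++M≡N++N z = *-cancelˡ-≡ (count z M) (count z N) 2 (begin
    2 * count z M              ≡⟨ cong (count z M +_) (+-identityʳ (count z M)) ⟩
    count z M + count z M      ≡⟨ count-++ z M M ⟨
    count z (M ++ M)           ≡⟨ M++M≡N++N z ⟩
    count z (N ++ N)           ≡⟨ count-++ z N N ⟩
    count z N + count z N      ≡⟨ cong (count z N +_) (+-identityʳ (count z N)) ⟨
    2 * count z N              ∎)
    where open ≡-Reasoning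

record IsWellOrder {A : Set} (_≈_ _≻_ : Rel A 0ℓ) : Set where
  field
    isEquivalence : IsEquivalence _≈_
    _≈?_          : Decidable _≈_
    respects      : ∀ {x x′ y y′} → x ≈ x′ → y ≈ y′ → x ≻ y → x′ ≻ y′
    total         : TotalUpTo _≈_ _≻_
    wellFounded   : WellFoundedGT _≻_

module MultisetExtension {A : Set} {_≈_ _≻_ : Rel A 0ℓ} (O : IsWellOrder _≈_ _≻_) where

  open IsWellOrder O
  open IsEquivalence isEquivalence renaming (refl to ≈-refl; sym to ≈-sym; trans to ≈-trans)
  open CountingMultisets isEquivalence _≈?_ _≻_ public
  open SetoidMembershipProperties using (∉[]; ∈-filter⁺; ∈-filter⁻)
  open PermutationProperties setoid using (shift)

  ≻-asym : ∀ {x y} → x ≻ y → ¬ (y ≻ x)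
  ≻-asym = wf⇒asym wellFounded

  ≻-irrefl : ∀ {x y} → x ≈ y → ¬ (x ≻ y)
  ≻-irrefl x≈y x≻y = ≻-asym x≻y (respects x≈y (≈-sym x≈y) x≻y)

  no-3-cycle : ∀ {x y z} → Acc (flip _≻_) x → x ≻ y → y ≻ z → ¬ (z ≻ x)
  no-3-cycle (acc rs) x≻y y≻z z≻x = no-3-cycle (rs x≻y) y≻z z≻x x≻y

  ≻-trans : ∀ {x y z} → x ≻ y → y ≻ z → x ≻ z
  ≻-trans {x} {y} {z} x≻y y≻z with total x z
  ... | inj₁ x≻z        = x≻z
  ... | inj₂ (inj₁ z≻x) = contradiction z≻x (no-3-cycle (wellFounded x) x≻y y≻z)
  ... | inj₂ (inj₂ x≈z) = contradiction (respects ≈-refl (≈-sym x≈z) y≻z) (≻-asym x≻y)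

  ≻-respʳ : ∀ {a} → (a ≻_) Respects _≈_
  ≻-respʳ = respects ≈-refl

  _≼_ : Rel A 0ℓ
  x ≼ y = y ≻ x ⊎ x ≈ y

  ≼-trans : ∀ {x y z} → x ≼ y → y ≼ z → x ≼ z
  ≼-trans (inj₁ y≻x) (inj₁ z≻y) = inj₁ (≻-trans z≻y y≻x)
  ≼-trans (inj₁ y≻x) (inj₂ y≈z) = inj₁ (respects y≈z ≈-refl y≻x)
  ≼-trans (inj₂ x≈y) (inj₁ z≻y) = inj₁ (respects ≈-refl (≈-sym x≈y) z≻y)
  ≼-trans (inj₂ x≈y) (inj₂ y≈z) = inj₂ (≈-trans x≈y y≈z)

  ≼-respˡ : ∀ {a} → (_≼ a) Respects _≈_
  ≼-respˡ x≈y = ≼-trans (inj₂ (≈-sym x≈y))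

  ≼⇒≯ : ∀ {x y} → x ≼ y → ¬ (x ≻ y)
  ≼⇒≯ (inj₁ y≻x) x≻y = ≻-asym x≻y y≻x
  ≼⇒≯ (inj₂ x≈y) x≻y = ≻-irrefl x≈y x≻y

  maximum : ∀ M → M ≡ [] ⊎ ∃[ m ] m ∈ M × All (_≼ m) M
  maximum [] = inj₁ refl
  maximum (x ∷ M) with maximum M
  ... | inj₁ refl = inj₂ (x , here ≈-refl , inj₂ ≈-refl ∷ [])
  ... | inj₂ (m , m∈M , M≼m) with total x m
  ...   | inj₁ x≻m        = inj₂ (x , here ≈-refl , inj₂ ≈-refl ∷
                                  All.map (λ w≼m → ≼-trans w≼m (inj₁ x≻m)) M≼m)
  ...   | inj₂ (inj₁ m≻x) = inj₂ (m , there m∈M , inj₁ m≻x ∷ M≼m)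
  ...   | inj₂ (inj₂ x≈m) = inj₂ (m , there m∈M , inj₂ x≈m ∷ M≼m)

  ≻≻-resp-↭ : ∀ {M M′ N N′} → M ↭ M′ → N ↭ N′ → M ≻≻ N → M′ ≻≻ N′
  ≻≻-resp-↭ M↭M′ N↭N′ (M≢N , dom) =
    (λ M′≡N′ → M≢N λ x → trans (M≡M′ x) (trans (M′≡N′ x) (sym (N≡N′ x)))) ,
    λ x M′<N′ → let y , y≻x , N<M = dom x (subst₂ _<_ (sym (M≡M′ x)) (sym (N≡N′ x)) M′<N′)
                in y , y≻x , subst₂ _<_ (N≡N′ y) (M≡M′ y) N<M
    where
    M≡M′ = ↭⇒≡ₘ M↭M′
    N≡N′ = ↭⇒≡ₘ N↭N′

  differ? : ∀ M N x → Dec (count x M ≢ count x N)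
  differ? M N x = ¬? (count x M ≟ count x N)

  differ-resp : ∀ M N → (λ x → count x M ≢ count x N) Respects _≈_
  differ-resp M N x≈y differ eq = differ (trans (count-resp M x≈y) (trans eq (sym (count-resp N x≈y))))

  differences : List A → List A → List A
  differences M N = filter (differ? M N) (M ++ N)

  differ⇒∈differences : ∀ {x} M N → count x M ≢ count x N → x ∈ differences M N
  differ⇒∈differences {x} M N differ = ∈-filter⁺ setoid (differ? M N) (differ-resp M N) x∈M++N differ
    where
    x∈M++N : x ∈ M ++ N
    x∈M++N = decidable-stable (any? (x ≈?_) (M ++ N)) λ x∉M++N →
      differ (trans (∉⇒count≡0 M (x∉M++N ∘ AnyP.++⁺ˡ)) (sym (∉⇒count≡0 N (x∉M++N ∘ AnyP.++⁺ʳ M))))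

  ∈differences⇒differ : ∀ {x} M N → x ∈ differences M N → count x M ≢ count x N
  ∈differences⇒differ M N x∈D = proj₂ (∈-filter⁻ setoid (differ? M N) (differ-resp M N) {xs = M ++ N} x∈D)

  differences-bounded : ∀ {m x} M N → All (_≼ m) (differences M N) → count x M ≢ count x N → x ≼ m
  differences-bounded M N D≼m differ = lookupₛ setoid ≼-respˡ D≼m (differ⇒∈differences M N differ)

  top-difference⇒≻≻ : ∀ {m} M N → (∀ {x} → count x M ≢ count x N → x ≼ m) →
                      count m N < count m M → M ≻≻ N
  top-difference⇒≻≻ {m} M N below N<M = (λ M≡N → <-irrefl (sym (M≡N m)) N<M) , dom
    where
    dom : ∀ x → count x M < count x N → ∃[ y ] y ≻ x × count y N < count y M
    dom x M<N with below (λ eq → <-irrefl eq M<N)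
    ... | inj₁ m≻x = m , m≻x , N<M
    ... | inj₂ x≈m = contradiction (subst₂ _<_ (count-resp M x≈m) (count-resp N x≈m) M<N) (<-asym N<M)

  ≻≻-total : TotalUpTo _≡ₘ_ _≻≻_
  ≻≻-total M N with maximum (differences M N)
  ... | inj₁ D≡[] = inj₂ (inj₂ λ x → decidable-stable (count x M ≟ count x N) λ differ →
          ∉[] setoid (subst (x ∈_) D≡[] (differ⇒∈differences M N differ)))
  ... | inj₂ (m , m∈D , D≼m) with <-cmp (count m M) (count m N)
  ...   | tri≈ _ eq _  = contradiction eq (∈differences⇒differ M N m∈D)
  ...   | tri> _ _ N<M = inj₁ (top-difference⇒≻≻ M N (differences-bounded M N D≼m) N<M)
  ...   | tri< M<N _ _ = inj₂ (inj₁ (top-difference⇒≻≻ N M (differences-bounded M N D≼m ∘ (_∘ sym)) M<N))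

  _≺≺_ : Rel (List A) 0ℓ
  _≺≺_ = flip _≻≻_

  Acc-resp-↭ : ∀ {M N} → M ↭ N → Acc _≺≺_ M → Acc _≺≺_ N
  Acc-resp-↭ M↭N (acc rs) = acc λ {K} N≻≻K → rs (≻≻-resp-↭ (↭-sym M↭N) (↭-refl {x = K}) N≻≻K)

  []-minimal : ∀ N → ¬ ([] ≻≻ N)
  []-minimal [] ([]≢[] , _) = []≢[] (λ _ → refl)
  []-minimal (y ∷ N) (_ , dom) with dom y (∈⇒count>0 (y ∷ N) (here ≈-refl))
  ... | _ , _ , ()

  acc-[] : Acc _≺≺_ []
  acc-[] = acc λ {N} []≻≻N → contradiction []≻≻N ([]-minimal N)

  count-above : ∀ {a y} M → All (_≼ a) M → y ≻ a → count y M ≡ 0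
  count-above M M≼a y≻a = ∉⇒count≡0 M λ y∈M → ≼⇒≯ (lookupₛ setoid ≼-respˡ M≼a y∈M) y≻a

  count-below : ∀ {a x} R → All (a ≻_) R → x ≈ a → count x R ≡ 0
  count-below R R<a x≈a = ∉⇒count≡0 R λ x∈R → ≻-irrefl (≈-sym x≈a) (lookupₛ setoid ≻-respʳ R<a x∈R)

  count-replicate-≈ : ∀ {a x} k → x ≈ a → count x (replicate k a) ≡ k
  count-replicate-≈ zero _ = refl
  count-replicate-≈ {a} {x} (suc k) x≈a with x ≈? a
  ... | yes _   = cong suc (count-replicate-≈ k x≈a)
  ... | no  x≉a = contradiction x≈a x≉a

  count-replicate-≉ : ∀ {a x} k → ¬ x ≈ a → count x (replicate k a) ≡ 0
  count-replicate-≉ zero _ = refl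
  count-replicate-≉ {a} {x} (suc k) x≉a with x ≈? a
  ... | yes x≈a = contradiction x≈a x≉a
  ... | no  _   = count-replicate-≉ k x≉a

  count-tower-≈ : ∀ {a x} k R → All (a ≻_) R → x ≈ a → count x (replicate k a ++ R) ≡ k
  count-tower-≈ {a} {x} k R R<a x≈a = begin
    count x (replicate k a ++ R)         ≡⟨ count-++ x (replicate k a) R ⟩
    count x (replicate k a) + count x R  ≡⟨ cong₂ _+_ (count-replicate-≈ k x≈a) (count-below R R<a x≈a) ⟩
    k + 0                                ≡⟨ +-identityʳ k ⟩
    k                                    ∎
    where open ≡-Reasoning

  count-tower-≉ : ∀ {a x} k R → ¬ x ≈ a → count x (replicate k a ++ R) ≡ count x R
  count-tower-≉ {a} {x} k R x≉a =
    trans (count-++ x (replicate k a) R) (cong (_+ count x R) (count-replicate-≉ k x≉a))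

  tower-bounded : ∀ {a} k {R} → All (a ≻_) R → All (_≼ a) (replicate k a ++ R)
  tower-bounded k R<a = AllP.++⁺ (AllP.replicate⁺ k (inj₂ ≈-refl)) (All.map inj₁ R<a)

  rest : A → List A → List A
  rest a = filter (λ x → ¬? (a ≈? x))

  decompose : ∀ a N → N ↭ replicate (count a N) a ++ rest a N
  decompose a [] = ↭-refl
  decompose a (y ∷ N) with a ≈? y
  ... | yes a≈y = prep (≈-sym a≈y) (decompose a N)
  ... | no  _   = ↭-trans (↭-prep y (decompose a N)) (↭-sym (shift ≈-refl (replicate (count a N) a) (rest a N)))

  rest-below : ∀ {a} N → All (_≼ a) N → All (a ≻_) (rest a N)
  rest-below [] [] = []
  rest-below {a} (y ∷ N) (y≼a ∷ N≼a) with a ≈? y | y≼a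
  ... | yes _   | _        = rest-below N N≼a
  ... | no  _   | inj₁ a≻y = a≻y ∷ rest-below N N≼a
  ... | no  a≉y | inj₂ y≈a = contradiction (≈-sym y≈a) a≉y

  ≻≻-bounded : ∀ {a M N} → All (_≼ a) M → M ≻≻ N → All (_≼ a) N
  ≻≻-bounded {a} {M} {N} M≼a (_ , dom) = All.tabulateₛ setoid bounded
    where
    bounded : ∀ {y} → y ∈ N → y ≼ a
    bounded {y} y∈N with total y a
    ... | inj₂ (inj₁ a≻y) = inj₁ a≻y
    ... | inj₂ (inj₂ y≈a) = inj₂ y≈a
    ... | inj₁ y≻a with dom y (subst (_< count y N) (sym (count-above M M≼a y≻a)) (∈⇒count>0 N y∈N))
    ...   | z , z≻y , N<M = contradiction (subst (count z N <_) (count-above M M≼a (≻-trans z≻y y≻a)) N<M) n≮0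

  tower-≻≻ : ∀ {a j k R R′} → All (a ≻_) R → All (a ≻_) R′ →
             (replicate k a ++ R) ≻≻ (replicate j a ++ R′) → j < k ⊎ (j ≡ k × R ≻≻ R′)
  tower-≻≻ {a} {j} {k} {R} {R′} R<a R′<a (M≢N , dom) with <-cmp j k
  ... | tri< j<k _ _ = inj₁ j<k
  ... | tri> _ _ k<j
    with dom a (subst₂ _<_ (sym (count-tower-≈ k R R<a ≈-refl)) (sym (count-tower-≈ j R′ R′<a ≈-refl)) k<j)
  ...   | z , z≻a , N<M =
    contradiction (subst (_ <_) (count-above (replicate k a ++ R) (tower-bounded k R<a) z≻a) N<M) n≮0
  tower-≻≻ {a} {j} {k} {R} {R′} R<a R′<a (M≢N , dom) | tri≈ _ refl _ =
    inj₂ (refl , M≢N ∘ ++⁺ˡ-≡ₘ (replicate k a) R R′ , dom′)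
    where
    dom′ : ∀ x → count x R < count x R′ → ∃[ y ] y ≻ x × count y R′ < count y R
    dom′ x R<R′ with x ≈? a
    ... | yes x≈a = contradiction (subst₂ _<_ (count-below R R<a x≈a) (count-below R′ R′<a x≈a) R<R′) n≮0
    ... | no  x≉a with dom x (subst₂ _<_ (sym (count-tower-≉ k R x≉a)) (sym (count-tower-≉ k R′ x≉a)) R<R′)
    ...   | y , y≻x , N<M with y ≈? a
    ...     | yes y≈a =
      contradiction (subst₂ _<_ (count-tower-≈ k R′ R′<a y≈a) (count-tower-≈ k R R<a y≈a) N<M) (<-irrefl refl)
    ...     | no  y≉a = y , y≻x , subst₂ _<_ (count-tower-≉ k R′ y≉a) (count-tower-≉ k R y≉a) N<M

  tower-descent : ∀ {a k R N} → All (a ≻_) R → (replicate k a ++ R) ≻≻ N →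
                  ∃[ j ] ∃[ R′ ] N ↭ (replicate j a ++ R′) × All (a ≻_) R′ ×
                                 (j < k ⊎ (j ≡ k × R ≻≻ R′))
  tower-descent {a} {k} {R} {N} R<a M≻≻N =
    count a N , rest a N , decompose a N , R′<a ,
    tower-≻≻ {j = count a N} {k} {R} R<a R′<a
             (≻≻-resp-↭ (↭-refl {x = replicate k a ++ R}) (decompose a N) M≻≻N)
    where
    R′<a = rest-below N (≻≻-bounded (tower-bounded k R<a) M≻≻N)

  acc-tower : ∀ {a} → (∀ R → All (a ≻_) R → Acc _≺≺_ R) →
              ∀ {k} → Acc _<_ k → ∀ {R} → All (a ≻_) R → Acc _≺≺_ R → Acc _≺≺_ (replicate k a ++ R)
  acc-tower {a} acc-below {k} (acc rk) = acc-tower-k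
    where
    acc-tower-k : ∀ {R} → All (a ≻_) R → Acc _≺≺_ R → Acc _≺≺_ (replicate k a ++ R)
    acc-tower-k {R} R<a (acc rR) = acc λ M≻≻N →
      let _ , _ , N↭N′ , R′<a , smaller = tower-descent R<a M≻≻N
      in Acc-resp-↭ (↭-sym N↭N′) (descend R′<a smaller)
      where
      descend : ∀ {j R′} → All (a ≻_) R′ → j < k ⊎ (j ≡ k × R ≻≻ R′) →
                Acc _≺≺_ (replicate j a ++ R′)
      descend R′<a (inj₁ j<k)            = acc-tower acc-below (rk j<k) R′<a (acc-below _ R′<a)
      descend R′<a (inj₂ (refl , R≻≻R′)) = acc-tower-k R′<a (rR R≻≻R′)

  acc-bounded : ∀ {a} → Acc (flip _≻_) a → ∀ M → All (_≼ a) M → Acc _≺≺_ M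
  acc-bounded {a} (acc rs) M M≼a =
    Acc-resp-↭ (↭-sym (decompose a M)) (acc-tower acc-below (<-wellFounded _) R<a (acc-below (rest a M) R<a))
    where
    R<a = rest-below M M≼a
    acc-below : ∀ R → All (a ≻_) R → Acc _≺≺_ R
    acc-below R R<a with maximum R
    ... | inj₁ refl            = acc-[]
    ... | inj₂ (m , m∈R , R≼m) = acc-bounded (rs (lookupₛ setoid ≻-respʳ R<a m∈R)) R R≼m

  ≻≻-wellFounded : WellFoundedGT _≻≻_
  ≻≻-wellFounded M with maximum M
  ... | inj₁ refl          = acc-[]
  ... | inj₂ (m , _ , M≼m) = acc-bounded (wellFounded m) M M≼m

module Closures (S : Signature) where

  open Over S

  AgreeOn : List Var → Subst → Subst → Set
  AgreeOn xs σ ρ = All (λ x → σ x ≡ ρ x) xs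

  mutual
    ·-cong-agree : ∀ t {σ ρ} → AgreeOn (vars t) σ ρ → t · σ ≡ t · ρ
    ·-cong-agree (var x)    (σx≡ρx ∷ []) = σx≡ρx
    ·-cong-agree (fun f ts) agree        = cong (fun f) (·*-cong-agree ts agree)

    ·*-cong-agree : ∀ {n} (ts : Vec Term n) {σ ρ} → AgreeOn (vars* ts) σ ρ → ts ·* σ ≡ ts ·* ρ
    ·*-cong-agree Vec.[]       _     = refl
    ·*-cong-agree (t Vec.∷ ts) agree =
      cong₂ Vec._∷_ (·-cong-agree t (AllP.++⁻ˡ (vars t) agree)) (·*-cong-agree ts (AllP.++⁻ʳ (vars t) agree))

  ground-agree : ∀ t {σ ρ} → Ground t → AgreeOn (vars t) σ ρ
  ground-agree t ground rewrite ground = []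

  ≈tc-isEquivalence : IsEquivalence _≈tc_
  ≈tc-isEquivalence = record
    { refl  = λ { {tc⟨ s , _ ⟩ , _} → refl , All.universal (λ _ → refl) (vars s) }
    ; sym   = λ { {tc⟨ _ , _ ⟩ , _} {tc⟨ _ , _ ⟩ , _} (refl , agree) → refl , All.map sym agree }
    ; trans = λ { {tc⟨ _ , _ ⟩ , _} {tc⟨ _ , _ ⟩ , _} {tc⟨ _ , _ ⟩ , _} (refl , agree) (refl , agree′) →
                  refl , All.zipWith (λ (p , q) → trans p q) (agree , agree′) }
    }

  open IsEquivalence ≈tc-isEquivalence using () renaming (refl to ≈tc-refl; trans to ≈tc-trans)

  ≈tc-setoid : Setoid 0ℓ 0ℓ
  ≈tc-setoid = record { isEquivalence = ≈tc-isEquivalence }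

  open Permutation ≈tc-setoid using () renaming (_↭_ to _↭tc_)
  open PermutationProperties ≈tc-setoid using (map⁺; Any-resp-↭) renaming (xs↭ys⇒|xs|≡|ys| to ↭tc⇒length≡)
  open SetoidMembership ≈tc-setoid using () renaming (_∈_ to _∈tc_)

  ∈-resp-↭tc : ∀ {c M N} → M ↭tc N → c ∈tc M → c ∈tc N
  ∈-resp-↭tc {c} = Any-resp-↭ λ {y} {y′} y≈y′ c≈y → ≈tc-trans {c} {y} {y′} c≈y y≈y′

  ≻tc-isWellOrder : ∀ {_≻t_ _≻tc_} → IsClosureOrderExtension _≻t_ _≻tc_ → IsWellOrder _≈tc_ _≻tc_
  ≻tc-isWellOrder ext = record
    { isEquivalence = ≈tc-isEquivalence
    ; _≈?_          = _≈tc?_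
    ; respects      = respects
    ; total         = total
    ; wellFounded   = wellFounded
    }
    where open IsClosureOrderExtension ext

  lhsClosure rhsClosure : GroundLiteralClosure → GroundTermClosure
  lhsClosure (lc⟨ lit _ s _ , θ ⟩ , gs , _) = tc⟨ s , θ ⟩ , gs
  rhsClosure (lc⟨ lit _ _ t , θ ⟩ , _ , gt) = tc⟨ t , θ ⟩ , gt

  lhs∈M-lc : ∀ x → lhsClosure x ∈tc M-lc x
  lhs∈M-lc x@(lc⟨ lit true  _ _ , _ ⟩ , _) = here (≈tc-refl {lhsClosure x})
  lhs∈M-lc x@(lc⟨ lit false _ _ , _ ⟩ , _) = here (≈tc-refl {lhsClosure x})

  rhs∈M-lc : ∀ x → rhsClosure x ∈tc M-lc x
  rhs∈M-lc x@(lc⟨ lit true  _ _ , _ ⟩ , _) = there (here (≈tc-refl {rhsClosure x}))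
  rhs∈M-lc x@(lc⟨ lit false _ _ , _ ⟩ , _) = there (there (here (≈tc-refl {rhsClosure x})))

  M-lc-agree : ∀ x c → c ∈tc M-lc x →
               AgreeOn (vars (TermClosure.term (proj₁ c))) (TermClosure.sub (proj₁ c)) (LiteralClosure.sub (proj₁ x))
  M-lc-agree (lc⟨ lit true  _ _ , _ ⟩ , _) (tc⟨ _ , _ ⟩ , _) (here (refl , agree))         = agree
  M-lc-agree (lc⟨ lit true  _ _ , _ ⟩ , _) (tc⟨ _ , _ ⟩ , _) (there (here (refl , agree))) = agree
  M-lc-agree (lc⟨ lit false _ _ , _ ⟩ , _) (tc⟨ _ , _ ⟩ , _) (here (refl , agree))         = agree
  M-lc-agree (lc⟨ lit false s _ , ρ ⟩ , gs , _) (tc⟨ _ , _ ⟩ , _) (there (here (refl , _))) =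
    ground-agree (s · ρ) gs
  M-lc-agree (lc⟨ lit false _ _ , _ ⟩ , _) (tc⟨ _ , _ ⟩ , _) (there (there (here (refl , agree)))) = agree
  M-lc-agree (lc⟨ lit false _ t , ρ ⟩ , _ , gt) (tc⟨ _ , _ ⟩ , _) (there (there (there (here (refl , _))))) =
    ground-agree (t · ρ) gt

  ↭-agree : ∀ x y → M-lc x ↭tc M-lc y → ∀ c → c ∈tc M-lc x →
            AgreeOn (vars (TermClosure.term (proj₁ c))) (TermClosure.sub (proj₁ c)) (LiteralClosure.sub (proj₁ y))
  ↭-agree _ y x↭y c c∈x = M-lc-agree y c (∈-resp-↭tc {c} x↭y c∈x)

  negative-side-≋ : ∀ s {θ ρ} (gθ : Ground (s · θ)) (gρ : Ground (s · ρ)) → AgreeOn (vars s) θ ρ →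
    Pointwise _≈tc_ ((tc⟨ s , θ ⟩ , gθ) ∷ (tc⟨ s · θ , idS ⟩ , groundId (s · θ) gθ) ∷ [])
                    ((tc⟨ s , ρ ⟩ , gρ) ∷ (tc⟨ s · ρ , idS ⟩ , groundId (s · ρ) gρ) ∷ [])
  negative-side-≋ s _ _ agree = (refl , agree) ∷ (·-cong-agree s agree , All.universal (λ _ → refl) _) ∷ []

  ≈lc⇒↭ : ∀ x y → x ≈lc y → M-lc x ↭tc M-lc y
  ≈lc⇒↭ (lc⟨ lit true s t , _ ⟩ , _) (lc⟨ lit .true .s .t , _ ⟩ , _) (refl , inj₁ (refl , refl) , agree) =
    Permutation.refl ((refl , AllP.++⁻ˡ (vars s) agree) ∷ (refl , AllP.++⁻ʳ (vars s) agree) ∷ [])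
  ≈lc⇒↭ (lc⟨ lit true s t , _ ⟩ , _) (lc⟨ lit .true .t .s , _ ⟩ , _) (refl , inj₂ (refl , refl) , agree) =
    Permutation.swap (refl , AllP.++⁻ˡ (vars s) agree) (refl , AllP.++⁻ʳ (vars s) agree) (Permutation.refl [])
  ≈lc⇒↭ (lc⟨ lit false s t , _ ⟩ , gs , gt) (lc⟨ lit .false .s .t , _ ⟩ , gs′ , gt′)
        (refl , inj₁ (refl , refl) , agree) =
    Permutation.refl (Pointwise.++⁺ (negative-side-≋ s gs gs′ (AllP.++⁻ˡ (vars s) agree))
                                    (negative-side-≋ t gt gt′ (AllP.++⁻ʳ (vars s) agree)))
  ≈lc⇒↭ (lc⟨ lit false s t , _ ⟩ , gs , gt) (lc⟨ lit .false .t .s , _ ⟩ , gt′ , gs′)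
        (refl , inj₂ (refl , refl) , agree) =
    Permutation.trans
      (Permutation.refl (Pointwise.++⁺ (negative-side-≋ s gs gs′ (AllP.++⁻ˡ (vars s) agree))
                                       (negative-side-≋ t gt gt′ (AllP.++⁻ʳ (vars s) agree))))
      (PermutationProperties.++-comm ≈tc-setoid (_ ∷ _ ∷ []) (_ ∷ _ ∷ []))

  module TermMultiset = CountingMultisets {Term} ≡.isEquivalence _≟T_ Never
  open TermMultiset using () renaming (_↭_ to _↭T_; _≡ₘ_ to _≡ₘT_)

  closureTerm closureInstance : GroundTermClosure → Term
  closureTerm     (tc⟨ s , _ ⟩ , _) = s
  closureInstance (tc⟨ s , σ ⟩ , _) = s · σ

  closureTerm-resp : closureTerm Preserves _≈tc_ ⟶ _≡_
  closureTerm-resp {tc⟨ _ , _ ⟩ , _} {tc⟨ _ , _ ⟩ , _} (s≡t , _) = s≡t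

  closureInstance-resp : closureInstance Preserves _≈tc_ ⟶ _≡_
  closureInstance-resp {tc⟨ s , _ ⟩ , _} {tc⟨ _ , _ ⟩ , _} (refl , agree) = ·-cong-agree s agree

  map-closureTerm : ∀ {M N} → M ↭tc N → map closureTerm M ↭T map closureTerm N
  map-closureTerm = map⁺ TermMultiset.setoid {f = closureTerm} (λ {x} {y} → closureTerm-resp {x} {y})

  map-closureInstance : ∀ {M N} → M ↭tc N → map closureInstance M ↭T map closureInstance N
  map-closureInstance = map⁺ TermMultiset.setoid {f = closureInstance} (λ {x} {y} → closureInstance-resp {x} {y})

  positive-sides : ∀ {s t θ u v ρ gs gt gu gv} →
    M-lc (lc⟨ lit true s t , θ ⟩ , gs , gt) ↭tc M-lc (lc⟨ lit true u v , ρ ⟩ , gu , gv) →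
    (s ∷ t ∷ []) ↭T (u ∷ v ∷ [])
  positive-sides = map-closureTerm

  -- For s ≉ t the closure terms of M-lc are s, sθ, t, tθ and its instances sθ, sθ, tθ, tθ; halving the
  -- latter fixes {sθ, tθ}, and cancelling that from the former leaves {s, t}.
  negative-sides : ∀ {s t θ u v ρ gs gt gu gv} →
    M-lc (lc⟨ lit false s t , θ ⟩ , gs , gt) ↭tc M-lc (lc⟨ lit false u v , ρ ⟩ , gu , gv) →
    (s ∷ t ∷ []) ↭T (u ∷ v ∷ [])
  negative-sides {s} {t} {θ} {u} {v} {ρ} x↭y =
    ≡ₘ⇒↭ (s ∷ t ∷ []) (u ∷ v ∷ []) (++-cancelʳ-≡ₘ (s ∷ t ∷ []) (u ∷ v ∷ []) terms instances)
    where
    open TermMultiset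
      using (↭-refl; ↭-sym; ↭-trans; ↭-prep; ↭-swap; ↭⇒≡ₘ; ≡ₘ⇒↭; ++-cancelʳ-≡ₘ; ++-halve-≡ₘ)

    interleave : ∀ {a b c d} → (a ∷ b ∷ c ∷ d ∷ []) ↭T (a ∷ c ∷ []) ++ (b ∷ d ∷ [])
    interleave {a} {b} {c} = ↭-prep a (↭-swap b c ↭-refl)

    instances-twice : ∀ a b → (a ∷ a · idS ∷ b ∷ b · idS ∷ []) ↭T (a ∷ b ∷ []) ++ (a ∷ b ∷ [])
    instances-twice a b = ↭-trans (TermMultiset.↭.refl (refl ∷ ·-id a ∷ refl ∷ ·-id b ∷ [])) interleave

    terms : ((s ∷ t ∷ []) ++ (s · θ ∷ t · θ ∷ [])) ≡ₘT ((u ∷ v ∷ []) ++ (u · ρ ∷ v · ρ ∷ []))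
    terms = ↭⇒≡ₘ (↭-trans (↭-sym interleave) (↭-trans (map-closureTerm x↭y) interleave))

    instances : (s · θ ∷ t · θ ∷ []) ≡ₘT (u · ρ ∷ v · ρ ∷ [])
    instances = ++-halve-≡ₘ _ _ (↭⇒≡ₘ (↭-trans (↭-sym (instances-twice (s · θ) (t · θ)))
                  (↭-trans (map-closureInstance x↭y) (instances-twice (u · ρ) (v · ρ)))))

  ↭⇒≈lc : ∀ x y → M-lc x ↭tc M-lc y → x ≈lc y
  ↭⇒≈lc x@(lc⟨ lit true _ _ , _ ⟩ , _) y@(lc⟨ lit true _ _ , _ ⟩ , _) x↭y =
    refl , TermMultiset.pair-↭ (positive-sides x↭y) ,
    AllP.++⁺ (↭-agree x y x↭y (lhsClosure x) (lhs∈M-lc x)) (↭-agree x y x↭y (rhsClosure x) (rhs∈M-lc x))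
  ↭⇒≈lc x@(lc⟨ lit false _ _ , _ ⟩ , _) y@(lc⟨ lit false _ _ , _ ⟩ , _) x↭y =
    refl , TermMultiset.pair-↭ (negative-sides x↭y) ,
    AllP.++⁺ (↭-agree x y x↭y (lhsClosure x) (lhs∈M-lc x)) (↭-agree x y x↭y (rhsClosure x) (rhs∈M-lc x))
  ↭⇒≈lc (lc⟨ lit true  _ _ , _ ⟩ , _) (lc⟨ lit false _ _ , _ ⟩ , _) x↭y with ↭tc⇒length≡ x↭y
  ... | ()
  ↭⇒≈lc (lc⟨ lit false _ _ , _ ⟩ , _) (lc⟨ lit true  _ _ , _ ⟩ , _) x↭y with ↭tc⇒length≡ x↭y
  ... | ()

  ≈lc-isEquivalence : IsEquivalence _≈lc_
  ≈lc-isEquivalence = record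
    { refl  = λ {x} → ↭⇒≈lc x x (Permutation.↭-refl ≈tc-setoid)
    ; sym   = λ {x} {y} x≈y → ↭⇒≈lc y x (Permutation.↭-sym ≈tc-setoid (≈lc⇒↭ x y x≈y))
    ; trans = λ {x} {y} {z} x≈y y≈z →
                ↭⇒≈lc x z (Permutation.↭-trans ≈tc-setoid (≈lc⇒↭ x y x≈y) (≈lc⇒↭ y z y≈z))
    }

  -- Taking ext rather than an arbitrary IsWellOrder _≈tc_ _≻tc_ keeps the decision procedure for ≈tc
  -- definitionally _≈tc?_, which is the one Orders uses to count.
  ≻lc-isWellOrder : ∀ {_≻t_ _≻tc_} → IsClosureOrderExtension _≻t_ _≻tc_ →
                    IsWellOrder _≈lc_ (Orders._≻lc_ _≻tc_)
  ≻lc-isWellOrder {_≻tc_ = _≻tc_} ext = record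
    { isEquivalence = ≈lc-isEquivalence
    ; _≈?_          = _≈lc?_
    ; respects      = λ {x} {x′} {y} {y′} x≈x′ y≈y′ →
                        ≻≻-resp-↭ (≈lc⇒↭ x x′ x≈x′) (≈lc⇒↭ y y′ y≈y′)
    ; total         = total
    ; wellFounded   = On.wellFounded M-lc ≻≻-wellFounded
    }
    where
    open MultisetExtension (≻tc-isWellOrder ext)
    total : TotalUpTo _≈lc_ (Orders._≻lc_ _≻tc_)
    total x y with ≻≻-total (M-lc x) (M-lc y)
    ... | inj₁ x≻y        = inj₁ x≻y
    ... | inj₂ (inj₁ y≻x) = inj₂ (inj₁ y≻x)
    ... | inj₂ (inj₂ x≡y) = inj₂ (inj₂ (↭⇒≈lc x y (≡ₘ⇒↭ (M-lc x) (M-lc y) x≡y)))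

lemma1 : (S : Signature) → let open Over S in
         (_≻t_ : Rel Term 0ℓ) → IsReductionOrdering _≻t_ →
         (_≻tc_ : Rel GroundTermClosure 0ℓ) → IsClosureOrderExtension _≻t_ _≻tc_ →
         let open Orders _≻tc_ in
         (WellFoundedGT _≻tc_ × TotalUpTo _≈tc_ _≻tc_)
         × (WellFoundedGT _≻lc_ × TotalUpTo _≈lc_ _≻lc_)
         × (WellFoundedGT _≻cc_ × TotalUpTo _≈cc_ _≻cc_)
lemma1 S _ _ _ ext =
  (wellFounded tc-order , total tc-order) ,
  (wellFounded lc-order , total lc-order) ,
  (On.wellFounded M-cc ≻≻-wellFounded , λ x y → ≻≻-total (M-cc x) (M-cc y))
  where
  open Over S
  open Closures S
  open IsWellOrder
  tc-order = ≻tc-isWellOrder ext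
  lc-order = ≻lc-isWellOrder ext
  open MultisetExtension lc-order using (≻≻-wellFounded; ≻≻-total)
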